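{- Let $n\ge 2$. A nonempty subset $D\subseteq S_n$ is a $2$-design in $(S_n,d_S)$ if and only if $\sum_{j=0}^n j f_j=n-1$ and $\sum_{j=0}^n j^2 f_j=1+(n-1)^2$. In particular, these conditions are satisfied if $|D|=n(n-1)$ and the frequencies of $D$ are $f_1=f_2=\dots=f_{n-2}=0$, $f_{n-1}=\frac{n-2}{n-1}$, $f_n=\frac{1}{n}$.
   Context: $S_n$ is the symmetric group on $n$ letters. For $\nu\in S_n$ let $F(\nu)$ be its number of fixed points; the metric is $d_S(\sigma,\theta)=n-F(\sigma\theta^{ -1})$. For $j\in\{0,\dots,n\}$ let $v_j$ be the number of permutations with exactly $n-j$ fixed points. For nonempty $D\subseteq S_n$, its frequencies are $f_i=|\{(x,y)\in D^2: d_S(x,y)=i\}|/|D|^2$, $i=0,\dots,n$. $D$ is a $t$-design if $\sum_{j=0}^n f_j j^i=\sum_{j=0}^n \frac{v_j}{n!} j^i$ for every $i=1,\dots,t$. -}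

module Defs where

open import Data.Nat as ℕ using (ℕ; zero; suc; _∸_; _≤_)
open import Data.Nat.Base using (_!)
open import Data.Integer using (+_)
open import Data.Rational as ℚ using (ℚ; _/_; 0ℚ)
open import Data.Fin using (Fin)
open import Data.Fin.Properties using (_≟_)
open import Data.Fin.Permutation using (Permutation′; _⟨$⟩ʳ_; _∘ₚ_; flip)
open import Data.Vec using (Vec; []; _∷_; lookup; toList)
open import Data.List using (List; []; _∷_; length; filter; allFin; upTo; map; concatMap; foldr; cartesianProduct)
open import Data.List.Relation.Unary.AllPairs using (AllPairs)
import Data.List.Relation.Unary.Unique.DecPropositional as UDP
open import Data.Product using (_×_; _,_; proj₁; proj₂)
open import Relation.Binary.PropositionalEquality using (_≡_)
open import Relation.Nullary using (¬_)
import Data.Nat.Properties as ℕP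

S : ℕ → Set
S n = Permutation′ n

F : ∀ {n} → S n → ℕ
F {n} ν = length (filter (λ i → ν ⟨$⟩ʳ i ≟ i) (allFin n))

-- σ θ⁻¹ as a function x ↦ σ (θ⁻¹ x)  (note: _∘ₚ_ is diagrammatic).
d_S : ∀ {n} → S n → S n → ℕ
d_S {n} σ θ = n ∸ F (flip θ ∘ₚ σ)

-- Enumeration of S_n for counting v_j: all tables Vec (Fin n) k, of which
-- the permutations of Fin n are exactly those with pairwise distinct entries.
allVecs : (n k : ℕ) → List (Vec (Fin n) k)
allVecs n zero = [] ∷ []
allVecs n (suc k) = concatMap (λ i → map (i ∷_) (allVecs n k)) (allFin n)

Ftab : ∀ {n} → Vec (Fin n) n → ℕ
Ftab {n} v = length (filter (λ i → lookup v i ≟ i) (allFin n))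

v : (n j : ℕ) → ℕ
v n j = length (filter (λ t → Ftab t ℕ.≟ (n ∸ j))
                 (filter (λ t → UDP.unique? (_≟_ {n}) (toList t)) (allVecs n n)))

-- a / b as a rational (b = 0 never occurs in use).
ratio : ℕ → ℕ → ℚ
ratio a zero = 0ℚ
ratio a (suc b) = (+ a) / suc b

-- A subset D ⊆ S_n, given as a duplicate-free list of permutations.
Distinct : ∀ {n} → List (S n) → Set
Distinct {n} = AllPairs (λ (σ θ : S n) → ¬ (∀ i → σ ⟨$⟩ʳ i ≡ θ ⟨$⟩ʳ i))

freq : ∀ {n} → List (S n) → ℕ → ℚ
freq D i = ratio (length (filter (λ p → d_S (proj₁ p) (proj₂ p) ℕ.≟ i)
                                 (cartesianProduct D D)))
                 (length D ℕ.* length D)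

Σ0to : ℕ → (ℕ → ℚ) → ℚ
Σ0to n g = foldr ℚ._+_ 0ℚ (map g (upTo (suc n)))

ℚof : ℕ → ℚ
ℚof j = (+ j) / 1

IsDesign : ∀ {n} → ℕ → List (S n) → Set
IsDesign {n} t D = ∀ i → 1 ≤ i → i ≤ t →
  Σ0to n (λ j → freq D j ℚ.* ℚof (j ℕ.^ i))
    ≡ Σ0to n (λ j → ratio (v n j) (n !) ℚ.* ℚof (j ℕ.^ i))

-- Write j = n − F(σ) for the distance of a uniformly random permutation σ to the identity,
-- so that Σ_j j^i v_j / n! is the i-th moment of n − F. The number of permutations with
-- σ p = a is independent of a, and for p ≠ q the number with σ p = a, σ q = b is
-- independent of a ≠ b: relabelling the values by a permutation moves any such
-- constraint to any other. Hence E[F] = 1 and, for n ≥ 2, E[F²] = 2, so that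
-- E[n − F] = n − 1 and E[(n − F)²] = n² − 2n + 2 = 1 + (n − 1)². The design equations
-- for i = 1, 2 are therefore exactly the two stated conditions. For the two-point
-- frequency distribution they read (n − 2) + 1 = n − 1 and (n − 2)(n − 1) + n = 1 + (n − 1)².
module Submission where

open import Defs
open import Data.Bool using (true; false; if_then_else_)
open import Data.Empty using (⊥; ⊥-elim)
open import Data.Fin using (Fin; zero; suc; toℕ)
open import Data.Fin.Permutation using (Permutation′; _⟨$⟩ʳ_; _⟨$⟩ˡ_; inverseˡ; transpose; _∘ₚ_)
open import Data.Fin.Properties using (_≟_; toℕ≤pred[n])
open import Data.Integer using (+_)
import Data.Integer as ℤ
import Data.Integer.Properties as ℤP
open import Data.List
  using (List; []; _∷_; _++_; length; map; filter; concatMap; tabulate; allFin; upTo; applyUpTo; foldr)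
import Data.List.Properties as ListP
open import Data.List.Relation.Binary.Permutation.Propositional using (_↭_; ↭-sym; ↭⇒↭ₛ)
open import Data.List.Relation.Binary.Permutation.Propositional.Properties using (shift)
import Data.List.Relation.Binary.Permutation.Setoid.Properties as PermSetoid
open import Data.List.Relation.Unary.All using ([]; _∷_)
open import Data.List.Relation.Unary.AllPairs using ([]; _∷_)
open import Data.List.Relation.Unary.Unique.Propositional using (Unique)
import Data.List.Relation.Unary.Unique.Propositional.Properties as Unique
import Data.List.Relation.Unary.Unique.DecPropositional as UniqueDec
open import Data.Nat using (ℕ; zero; suc; _≤_; _<_; z≤n; s≤s; _∸_; _+_; _*_; _^_; _!; NonZero)
import Data.Nat as ℕ
import Data.Nat.Properties as ℕP
open import Algebra.Properties.Semiring.Sum ℕP.+-*-semiring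
  using (sum-syntax; sum-cong-≗; ∑-distrib-+; ∑-comm; sum-permute; sum-replicate-zero;
         *-distribˡ-sum; *-distribʳ-sum)
open import Data.Nat.Tactic.RingSolver using (solve-∀)
open import Data.Product using (_×_; Σ-syntax; _,_)
open import Data.Rational using (ℚ; 0ℚ) renaming (_*_ to _*ℚ_)
import Data.Rational as ℚ
import Data.Rational.Properties as ℚP
open import Data.Rational.Unnormalised using (mkℚᵘ; *≡*) renaming (_≃_ to _≃ᵘ_)
import Data.Rational.Unnormalised as ℚᵘ
import Data.Rational.Unnormalised.Properties as ℚᵘP
open import Data.Vec using (Vec; toList; lookup)
import Data.Vec as Vec
import Data.Vec.Properties as VecP
import Data.Vec.Relation.Unary.All.Properties as VecAll
open import Data.Vec.Relation.Unary.AllPairs using ([]; _∷_)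
import Data.Vec.Relation.Unary.Unique.Propositional as VecUnique
import Data.Vec.Relation.Unary.Unique.Propositional.Properties as VecUnique
open import Function.Bundles using (_⇔_; mk⇔)
open import Relation.Binary.PropositionalEquality
  using (_≡_; _≢_; refl; sym; trans; cong; cong₂; setoid; module ≡-Reasoning)
open import Relation.Nullary using (Dec; does; yes; no; ¬_)
open import Relation.Nullary.Decidable using (dec-true; dec-false)

-- Definitionally equal to ratio a (suc b), and to ℚof a when b = 0.
_/1+_ : ℕ → ℕ → ℚ
a /1+ b = ℚ.fromℚᵘ (mkℚᵘ (+ a) b)

≃ᵘ-from-ℕ : ∀ {a b c d} → a * suc d ≡ c * suc b → mkℚᵘ (+ a) b ≃ᵘ mkℚᵘ (+ c) d
≃ᵘ-from-ℕ {a} {b} {c} {d} eq =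
  *≡* (trans (sym (ℤP.pos-* a (suc d))) (trans (cong +_ eq) (ℤP.pos-* c (suc b))))

/1+-cong : ∀ a b c d → a * suc d ≡ c * suc b → a /1+ b ≡ c /1+ d
/1+-cong a b c d eq = ℚP.fromℚᵘ-cong {mkℚᵘ (+ a) b} {mkℚᵘ (+ c) d} (≃ᵘ-from-ℕ eq)

toℚᵘ-/1+ : ∀ a b → ℚ.toℚᵘ (a /1+ b) ≃ᵘ mkℚᵘ (+ a) b
toℚᵘ-/1+ a b = ℚP.toℚᵘ-fromℚᵘ (mkℚᵘ (+ a) b)

/1+-+ : ∀ a c b → a /1+ b ℚ.+ c /1+ b ≡ (a + c) /1+ b
/1+-+ a c b = ℚP.toℚᵘ-injective (begin
  ℚ.toℚᵘ (a /1+ b ℚ.+ c /1+ b)                   ≈⟨ ℚP.toℚᵘ-homo-+ (a /1+ b) (c /1+ b) ⟩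
  ℚ.toℚᵘ (a /1+ b) ℚᵘ.+ ℚ.toℚᵘ (c /1+ b)          ≈⟨ ℚᵘP.+-cong (toℚᵘ-/1+ a b) (toℚᵘ-/1+ c b) ⟩
  mkℚᵘ (+ a ℤ.* + suc b ℤ.+ + c ℤ.* + suc b) b′  ≡⟨ cong (λ z → mkℚᵘ z b′) numerator ⟩
  mkℚᵘ (+ (a * suc b + c * suc b)) b′            ≈⟨ ≃ᵘ-from-ℕ (cross-multiply a c b) ⟩
  mkℚᵘ (+ (a + c)) b                             ≈⟨ ℚᵘP.≃-sym (toℚᵘ-/1+ (a + c) b) ⟩
  ℚ.toℚᵘ ((a + c) /1+ b)                         ∎)
  where
  open ℚᵘP.≃-Reasoning
  b′ : ℕ
  b′ = b + b * suc b
  numerator : + a ℤ.* + suc b ℤ.+ + c ℤ.* + suc b ≡ + (a * suc b + c * suc b)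
  numerator = trans (cong₂ ℤ._+_ (sym (ℤP.pos-* a (suc b))) (sym (ℤP.pos-* c (suc b))))
                    (sym (ℤP.pos-+ (a * suc b) (c * suc b)))
  cross-multiply : ∀ a c b → (a * suc b + c * suc b) * suc b ≡ (a + c) * suc (b + b * suc b)
  cross-multiply = solve-∀

/1+-*-ℚof : ∀ a b c → a /1+ b *ℚ ℚof c ≡ (a * c) /1+ b
/1+-*-ℚof a b c = ℚP.toℚᵘ-injective (begin
  ℚ.toℚᵘ (a /1+ b *ℚ c /1+ 0)                     ≈⟨ ℚP.toℚᵘ-homo-* (a /1+ b) (c /1+ 0) ⟩
  ℚ.toℚᵘ (a /1+ b) ℚᵘ.* ℚ.toℚᵘ (c /1+ 0)          ≈⟨ ℚᵘP.*-cong (toℚᵘ-/1+ a b) (toℚᵘ-/1+ c 0) ⟩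
  mkℚᵘ (+ a ℤ.* + c) (0 + b * 1)                 ≡⟨ cong (λ z → mkℚᵘ z (0 + b * 1)) (sym (ℤP.pos-* a c)) ⟩
  mkℚᵘ (+ (a * c)) (0 + b * 1)                   ≈⟨ ≃ᵘ-from-ℕ (cong (a * c *_) (cong suc (sym (ℕP.*-identityʳ b)))) ⟩
  mkℚᵘ (+ (a * c)) b                             ≈⟨ ℚᵘP.≃-sym (toℚᵘ-/1+ (a * c) b) ⟩
  ℚ.toℚᵘ ((a * c) /1+ b)                         ∎)
  where open ℚᵘP.≃-Reasoning

*-/1+-cancel : ∀ c b → (c * suc b) /1+ b ≡ ℚof c
*-/1+-cancel c b = /1+-cong (c * suc b) b c 0 (ℕP.*-identityʳ (c * suc b))

-- Defined through `does`, so that δ (suc a) (suc b) reduces to δ a b.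
𝟙 : ∀ {p} {P : Set p} → Dec P → ℕ
𝟙 P? = if does P? then 1 else 0

𝟙-yes : ∀ {p} {P : Set p} → P → (P? : Dec P) → 𝟙 P? ≡ 1
𝟙-yes _ (yes _) = refl
𝟙-yes x (no ¬x) = ⊥-elim (¬x x)

𝟙-no : ∀ {p} {P : Set p} → ¬ P → (P? : Dec P) → 𝟙 P? ≡ 0
𝟙-no ¬x (yes x) = ⊥-elim (¬x x)
𝟙-no _ (no _) = refl

𝟙-cong : ∀ {p q} {P : Set p} {Q : Set q} → (P → Q) → (Q → P) →
         (P? : Dec P) (Q? : Dec Q) → 𝟙 P? ≡ 𝟙 Q?
𝟙-cong P→Q Q→P (yes x) Q? = sym (𝟙-yes (P→Q x) Q?)
𝟙-cong P→Q Q→P (no ¬x) Q? = sym (𝟙-no (λ y → ¬x (Q→P y)) Q?)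

∑ₗ : ∀ {a} {A : Set a} → (A → ℕ) → List A → ℕ
∑ₗ h []       = 0
∑ₗ h (x ∷ xs) = h x + ∑ₗ h xs

module _ {a} {A : Set a} where

  ∑ₗ-cong : ∀ {f g : A → ℕ} → (∀ x → f x ≡ g x) → ∀ xs → ∑ₗ f xs ≡ ∑ₗ g xs
  ∑ₗ-cong f≗g []       = refl
  ∑ₗ-cong f≗g (x ∷ xs) = cong₂ _+_ (f≗g x) (∑ₗ-cong f≗g xs)

  ∑ₗ-++ : ∀ (h : A → ℕ) xs ys → ∑ₗ h (xs ++ ys) ≡ ∑ₗ h xs + ∑ₗ h ys
  ∑ₗ-++ h []       ys = refl
  ∑ₗ-++ h (x ∷ xs) ys = trans (cong (_+_ (h x)) (∑ₗ-++ h xs ys)) (sym (ℕP.+-assoc (h x) _ _))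

  ∑ₗ-*ˡ : ∀ c (h : A → ℕ) xs → ∑ₗ (λ x → c * h x) xs ≡ c * ∑ₗ h xs
  ∑ₗ-*ˡ c h []       = sym (ℕP.*-zeroʳ c)
  ∑ₗ-*ˡ c h (x ∷ xs) = trans (cong (_+_ (c * h x)) (∑ₗ-*ˡ c h xs)) (sym (ℕP.*-distribˡ-+ c (h x) _))

  ∑ₗ-filter : ∀ {p} {P : A → Set p} (P? : ∀ x → Dec (P x)) (h : A → ℕ) xs →
              ∑ₗ h (filter P? xs) ≡ ∑ₗ (λ x → 𝟙 (P? x) * h x) xs
  ∑ₗ-filter P? h [] = refl
  ∑ₗ-filter P? h (x ∷ xs) with does (P? x)
  ... | true  = cong₂ _+_ (sym (ℕP.*-identityˡ (h x))) (∑ₗ-filter P? h xs)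
  ... | false = ∑ₗ-filter P? h xs

  length-filter : ∀ {p} {P : A → Set p} (P? : ∀ x → Dec (P x)) xs →
                  length (filter P? xs) ≡ ∑ₗ (λ x → 𝟙 (P? x)) xs
  length-filter P? [] = refl
  length-filter P? (x ∷ xs) with does (P? x)
  ... | true  = cong suc (length-filter P? xs)
  ... | false = length-filter P? xs

module _ {a b} {A : Set a} {B : Set b} where

  ∑ₗ-map : ∀ (h : B → ℕ) (f : A → B) xs → ∑ₗ h (map f xs) ≡ ∑ₗ (λ x → h (f x)) xs
  ∑ₗ-map h f []       = refl
  ∑ₗ-map h f (x ∷ xs) = cong (_+_ (h (f x))) (∑ₗ-map h f xs)

  ∑ₗ-concatMap : ∀ (h : B → ℕ) (f : A → List B) xs →
                 ∑ₗ h (concatMap f xs) ≡ ∑ₗ (λ x → ∑ₗ h (f x)) xs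
  ∑ₗ-concatMap h f []       = refl
  ∑ₗ-concatMap h f (x ∷ xs) =
    trans (∑ₗ-++ h (f x) (concatMap f xs)) (cong (_+_ (∑ₗ h (f x))) (∑ₗ-concatMap h f xs))

∑-const : ∀ n c → ∑[ i < n ] c ≡ n * c
∑-const zero    c = refl
∑-const (suc n) c = cong (_+_ c) (∑-const n c)

∑ₗ-tabulate : ∀ {a} {A : Set a} {n} (h : A → ℕ) (f : Fin n → A) →
              ∑ₗ h (tabulate f) ≡ ∑[ i < n ] h (f i)
∑ₗ-tabulate {n = zero}  h f = refl
∑ₗ-tabulate {n = suc n} h f = cong (_+_ (h (f zero))) (∑ₗ-tabulate h (λ i → f (suc i)))

∑ₗ-applyUpTo : ∀ (h : ℕ → ℕ) f N → ∑ₗ h (applyUpTo f N) ≡ ∑[ i < N ] h (f (toℕ i))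
∑ₗ-applyUpTo h f zero    = refl
∑ₗ-applyUpTo h f (suc N) = cong (_+_ (h (f 0))) (∑ₗ-applyUpTo h (λ j → f (suc j)) N)

∑-toℕ-select : ∀ {N} c (g : ℕ → ℕ) → c < N → ∑[ i < N ] (𝟙 (toℕ i ℕ.≟ c) * g (toℕ i)) ≡ g c
∑-toℕ-select {suc N} zero    g _         =
  trans (cong (_+_ (g 0 + 0)) (sum-replicate-zero N)) (trans (ℕP.+-identityʳ _) (ℕP.+-identityʳ _))
∑-toℕ-select {suc N} (suc c) g (s≤s c<N) = ∑-toℕ-select c (λ j → g (suc j)) c<N

δ : ∀ {n} → Fin n → Fin n → ℕ
δ a b = 𝟙 (a ≟ b)

δ-sym : ∀ {n} (a b : Fin n) → δ a b ≡ δ b a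
δ-sym a b = 𝟙-cong sym sym (a ≟ b) (b ≟ a)

δ-idem : ∀ {n} (a b : Fin n) → δ a b * δ a b ≡ δ a b
δ-idem a b with does (a ≟ b)
... | true  = refl
... | false = refl

∑-δ-* : ∀ {n} (a : Fin n) (f : Fin n → ℕ) → ∑[ b < n ] (δ a b * f b) ≡ f a
∑-δ-* {suc n} zero    f =
  trans (cong (_+_ (f zero + 0)) (sum-replicate-zero n)) (trans (ℕP.+-identityʳ _) (ℕP.+-identityʳ _))
∑-δ-* {suc n} (suc a) f = ∑-δ-* a (λ b → f (suc b))

∑-δ : ∀ {n} (a : Fin n) → ∑[ b < n ] δ a b ≡ 1
∑-δ a = trans (sum-cong-≗ (λ b → sym (ℕP.*-identityʳ (δ a b)))) (∑-δ-* a (λ _ → 1))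

∑-1∸δ : ∀ {n} (a : Fin n) → ∑[ b < n ] (1 ∸ δ a b) ≡ n ∸ 1
∑-1∸δ {suc n}       zero    = trans (∑-const n 1) (ℕP.*-identityʳ n)
∑-1∸δ {suc (suc n)} (suc a) = cong suc (∑-1∸δ a)

δ-*-δ≡0 : ∀ {n} {x a y b : Fin n} → (x ≡ a → y ≡ b → ⊥) → δ x a * δ y b ≡ 0
δ-*-δ≡0 {x = x} {a} {y} {b} clash with x ≟ a | y ≟ b
... | yes x≡a | yes y≡b = ⊥-elim (clash x≡a y≡b)
... | yes _   | no _    = refl
... | no _    | _       = refl

module _ {n : ℕ} where

  ∑ᵛ : ∀ k → (Vec (Fin n) k → ℕ) → ℕ
  ∑ᵛ zero    h = h Vec.[]
  ∑ᵛ (suc k) h = ∑[ i < n ] ∑ᵛ k (λ w → h (i Vec.∷ w))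

  ∑ᵛ-cong : ∀ k {f g : Vec (Fin n) k → ℕ} → (∀ w → f w ≡ g w) → ∑ᵛ k f ≡ ∑ᵛ k g
  ∑ᵛ-cong zero    f≗g = f≗g Vec.[]
  ∑ᵛ-cong (suc k) f≗g = sum-cong-≗ {n} (λ i → ∑ᵛ-cong k (λ w → f≗g (i Vec.∷ w)))

  ∑ᵛ-+ : ∀ k (f g : Vec (Fin n) k → ℕ) → ∑ᵛ k (λ w → f w + g w) ≡ ∑ᵛ k f + ∑ᵛ k g
  ∑ᵛ-+ zero    f g = refl
  ∑ᵛ-+ (suc k) f g = trans (sum-cong-≗ {n} (λ i → ∑ᵛ-+ k (λ w → f (i Vec.∷ w)) (λ w → g (i Vec.∷ w))))
                           (∑-distrib-+ {n} _ _)

  ∑ᵛ-*ˡ : ∀ k c (f : Vec (Fin n) k → ℕ) → ∑ᵛ k (λ w → c * f w) ≡ c * ∑ᵛ k f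
  ∑ᵛ-*ˡ zero    c f = refl
  ∑ᵛ-*ˡ (suc k) c f = trans (sum-cong-≗ {n} (λ i → ∑ᵛ-*ˡ k c (λ w → f (i Vec.∷ w))))
                            (sym (*-distribˡ-sum c (λ i → ∑ᵛ k (λ w → f (i Vec.∷ w)))))

  ∑ᵛ-zero : ∀ k {h : Vec (Fin n) k → ℕ} → (∀ w → h w ≡ 0) → ∑ᵛ k h ≡ 0
  ∑ᵛ-zero k h≗0 = trans (∑ᵛ-cong k h≗0) (∑ᵛ-*ˡ k 0 (λ _ → 0))

  ∑ᵛ-∑-comm : ∀ k {m} (h : Vec (Fin n) k → Fin m → ℕ) →
              ∑ᵛ k (λ w → ∑[ i < m ] h w i) ≡ ∑[ i < m ] ∑ᵛ k (λ w → h w i)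
  ∑ᵛ-∑-comm zero    h = refl
  ∑ᵛ-∑-comm (suc k) h = trans (sum-cong-≗ {n} (λ j → ∑ᵛ-∑-comm k (λ w → h (j Vec.∷ w))))
                              (∑-comm (λ j i → ∑ᵛ k (λ w → h (j Vec.∷ w) i)))

  ∑ᵛ-relabel : ∀ k (ρ : Permutation′ n) (h : Vec (Fin n) k → ℕ) →
               ∑ᵛ k (λ w → h (Vec.map (ρ ⟨$⟩ʳ_) w)) ≡ ∑ᵛ k h
  ∑ᵛ-relabel zero    ρ h = refl
  ∑ᵛ-relabel (suc k) ρ h =
    trans (sum-cong-≗ {n} (λ i → ∑ᵛ-relabel k ρ (λ w → h ((ρ ⟨$⟩ʳ i) Vec.∷ w))))
          (sym (sum-permute (λ i → ∑ᵛ k (λ w → h (i Vec.∷ w))) ρ))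

  ∑ₗ-allVecs : ∀ k (h : Vec (Fin n) k → ℕ) → ∑ₗ h (allVecs n k) ≡ ∑ᵛ k h
  ∑ₗ-allVecs zero    h = ℕP.+-identityʳ (h Vec.[])
  ∑ₗ-allVecs (suc k) h = begin
    ∑ₗ h (allVecs n (suc k))                                 ≡⟨ ∑ₗ-concatMap h _ (allFin n) ⟩
    ∑ₗ (λ i → ∑ₗ h (map (i Vec.∷_) (allVecs n k))) (allFin n) ≡⟨ ∑ₗ-cong (λ i → ∑ₗ-map h (i Vec.∷_) (allVecs n k)) (allFin n) ⟩
    ∑ₗ (λ i → ∑ₗ (λ w → h (i Vec.∷ w)) (allVecs n k)) (allFin n) ≡⟨ ∑ₗ-tabulate (λ i → ∑ₗ (λ w → h (i Vec.∷ w)) (allVecs n k)) (λ i → i) ⟩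
    ∑[ i < n ] ∑ₗ (λ w → h (i Vec.∷ w)) (allVecs n k)           ≡⟨ sum-cong-≗ {n} (λ i → ∑ₗ-allVecs k _) ⟩
    ∑ᵛ (suc k) h                                             ∎
    where open ≡-Reasoning

  ∑ₗ-∑ᵛ-comm : ∀ {a} {A : Set a} k (h : A → Vec (Fin n) k → ℕ) xs →
               ∑ₗ (λ x → ∑ᵛ k (h x)) xs ≡ ∑ᵛ k (λ w → ∑ₗ (λ x → h x w) xs)
  ∑ₗ-∑ᵛ-comm k h []       = sym (∑ᵛ-zero k (λ _ → refl))
  ∑ₗ-∑ᵛ-comm k h (x ∷ xs) =
    trans (cong (_+_ (∑ᵛ k (h x))) (∑ₗ-∑ᵛ-comm k h xs)) (sym (∑ᵛ-+ k (h x) _))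

-- Counting duplicate-free tables

_↓_ : ℕ → ℕ → ℕ
m ↓ zero  = 1
m ↓ suc k = m * (ℕ.pred m ↓ k)

↓-self : ∀ m → m ↓ m ≡ m !
↓-self zero    = refl
↓-self (suc m) = cong (suc m *_) (↓-self m)

module _ {n : ℕ} where

  uniq : List (Fin n) → ℕ
  uniq xs = 𝟙 (UniqueDec.unique? _≟_ xs)

  uniq-yes : ∀ {xs} → Unique xs → uniq xs ≡ 1
  uniq-yes {xs} u = 𝟙-yes u (UniqueDec.unique? _≟_ xs)

  uniq-no : ∀ {xs} → ¬ Unique xs → uniq xs ≡ 0
  uniq-no {xs} ¬u = 𝟙-no ¬u (UniqueDec.unique? _≟_ xs)

  uniq-cong : ∀ {xs ys} → (Unique xs → Unique ys) → (Unique ys → Unique xs) → uniq xs ≡ uniq ys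
  uniq-cong {xs} {ys} f g = 𝟙-cong f g (UniqueDec.unique? _≟_ xs) (UniqueDec.unique? _≟_ ys)

  Unique-resp-↭ : ∀ {xs ys : List (Fin n)} → xs ↭ ys → Unique xs → Unique ys
  Unique-resp-↭ p = PermSetoid.Unique-resp-↭ (setoid (Fin n)) (↭⇒↭ₛ p)

  Unique-++⁻ʳ : ∀ (xs : List (Fin n)) {ys} → Unique (xs ++ ys) → Unique ys
  Unique-++⁻ʳ []       u       = u
  Unique-++⁻ʳ (x ∷ xs) (_ ∷ u) = Unique-++⁻ʳ xs u

  uniq-shift : ∀ xs i ys → uniq (i ∷ xs ++ ys) ≡ uniq (xs ++ i ∷ ys)
  uniq-shift xs i ys =
    uniq-cong (Unique-resp-↭ (↭-sym (shift i xs ys))) (Unique-resp-↭ (shift i xs ys))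

  fresh : List (Fin n) → ℕ
  fresh ys = ∑[ i < n ] uniq (i ∷ ys)

  fresh-[] : fresh [] ≡ n
  fresh-[] = trans (sum-cong-≗ {n} (λ i → uniq-yes {i ∷ []} ([] ∷ [])))
                   (trans (∑-const n 1) (ℕP.*-identityʳ n))

  fresh-∷ : ∀ i ys → Unique (i ∷ ys) → fresh ys ≡ suc (fresh (i ∷ ys))
  fresh-∷ i ys u = begin
    fresh ys                                          ≡⟨ sum-cong-≗ {n} (λ j → split j (j ≟ i)) ⟩
    ∑[ j < n ] (uniq (j ∷ i ∷ ys) + δ j i)            ≡⟨ ∑-distrib-+ (λ j → uniq (j ∷ i ∷ ys)) (λ j → δ j i) ⟩
    fresh (i ∷ ys) + ∑[ j < n ] δ j i                 ≡⟨ cong (_+_ (fresh (i ∷ ys))) (trans (sum-cong-≗ {n} (λ j → δ-sym j i)) (∑-δ i)) ⟩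
    fresh (i ∷ ys) + 1                                ≡⟨ ℕP.+-comm _ 1 ⟩
    suc (fresh (i ∷ ys))                              ∎
    where
    open ≡-Reasoning
    split : ∀ j → Dec (j ≡ i) → uniq (j ∷ ys) ≡ uniq (j ∷ i ∷ ys) + δ j i
    split j (yes refl) = trans (uniq-yes u)
      (cong₂ _+_ (sym (uniq-no {i ∷ i ∷ ys} (λ { ((i≢i ∷ _) ∷ _) → i≢i refl }))) (sym (𝟙-yes refl (i ≟ i))))
    split j (no j≢i) = trans
      (uniq-cong {j ∷ ys} {j ∷ i ∷ ys} (λ { (j∉ys ∷ _) → (j≢i ∷ j∉ys) ∷ u }) (λ { ((_ ∷ j∉ys) ∷ _ ∷ u′) → j∉ys ∷ u′ }))
      (sym (trans (cong (_+_ (uniq (j ∷ i ∷ ys))) (𝟙-no j≢i (j ≟ i))) (ℕP.+-identityʳ _)))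

  ∑ᵛ-uniq-++ : ∀ k ys → Unique ys → ∑ᵛ k (λ w → uniq (toList w ++ ys)) ≡ fresh ys ↓ k
  ∑ᵛ-uniq-++ zero    ys u = uniq-yes u
  ∑ᵛ-uniq-++ (suc k) ys u =
    trans (sum-cong-≗ {n} prepend) (sym (*-distribʳ-sum (ℕ.pred (fresh ys) ↓ k) (λ i → uniq (i ∷ ys))))
    where
    prepend : ∀ i → ∑ᵛ k (λ w → uniq (i ∷ toList w ++ ys)) ≡ uniq (i ∷ ys) * (ℕ.pred (fresh ys) ↓ k)
    prepend i with UniqueDec.unique? _≟_ (i ∷ ys)
    ... | yes u′ = begin
      ∑ᵛ k (λ w → uniq (i ∷ toList w ++ ys))   ≡⟨ ∑ᵛ-cong k (λ w → uniq-shift (toList w) i ys) ⟩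
      ∑ᵛ k (λ w → uniq (toList w ++ i ∷ ys))   ≡⟨ ∑ᵛ-uniq-++ k (i ∷ ys) u′ ⟩
      fresh (i ∷ ys) ↓ k                       ≡⟨ cong (λ m → ℕ.pred m ↓ k) (fresh-∷ i ys u′) ⟨
      ℕ.pred (fresh ys) ↓ k                    ≡⟨ ℕP.*-identityˡ _ ⟨
      1 * (ℕ.pred (fresh ys) ↓ k)              ≡⟨ cong (_* (ℕ.pred (fresh ys) ↓ k)) (uniq-yes u′) ⟨
      uniq (i ∷ ys) * (ℕ.pred (fresh ys) ↓ k)  ∎
      where open ≡-Reasoning
    ... | no ¬u′ = trans (∑ᵛ-zero k (λ w → uniq-no (λ u″ → ¬u′ (Unique-++⁻ʳ (toList w)
                                   (Unique-resp-↭ (↭-sym (shift i (toList w) ys)) u″)))))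
                         (cong (_* (ℕ.pred (fresh ys) ↓ k)) (sym (uniq-no ¬u′)))

  isPerm : Vec (Fin n) n → ℕ
  isPerm w = uniq (toList w)

  ∑ᵛ-isPerm : ∑ᵛ n isPerm ≡ n !
  ∑ᵛ-isPerm = begin
    ∑ᵛ n isPerm                             ≡⟨ ∑ᵛ-cong n (λ w → cong uniq (ListP.++-identityʳ (toList w))) ⟨
    ∑ᵛ n (λ w → uniq (toList w ++ []))      ≡⟨ ∑ᵛ-uniq-++ n [] [] ⟩
    fresh [] ↓ n                            ≡⟨ cong (_↓ n) fresh-[] ⟩
    n ↓ n                                   ≡⟨ ↓-self n ⟩
    n !                                     ∎
    where open ≡-Reasoning

-- Permutations with prescribed values

module _ {n : ℕ} where

  ⟨$⟩ʳ-injective : ∀ (ρ : Permutation′ n) {x y} → ρ ⟨$⟩ʳ x ≡ ρ ⟨$⟩ʳ y → x ≡ y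
  ⟨$⟩ʳ-injective ρ {x} {y} eq = trans (sym (inverseˡ ρ)) (trans (cong (ρ ⟨$⟩ˡ_) eq) (inverseˡ ρ))

  transpose-source : ∀ (i j : Fin n) → transpose i j ⟨$⟩ʳ i ≡ j
  transpose-source i j rewrite dec-true (i ≟ i) refl = refl

  transpose-other : ∀ (i j k : Fin n) → k ≢ i → k ≢ j → transpose i j ⟨$⟩ʳ k ≡ k
  transpose-other i j k k≢i k≢j rewrite dec-false (k ≟ i) k≢i | dec-false (k ≟ j) k≢j = refl

  relabelling₂ : ∀ {p q a b : Fin n} → p ≢ q → a ≢ b →
                 Σ[ ρ ∈ Permutation′ n ] (ρ ⟨$⟩ʳ p ≡ a × ρ ⟨$⟩ʳ q ≡ b)
  relabelling₂ {p} {q} {a} {b} p≢q a≢b = τ ∘ₚ σ , σ-fixes-a , transpose-source q′ b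
    where
    τ σ : Permutation′ n
    q′ : Fin n
    τ = transpose p a
    q′ = τ ⟨$⟩ʳ q
    σ = transpose q′ b
    σ-fixes-a : σ ⟨$⟩ʳ (τ ⟨$⟩ʳ p) ≡ a
    σ-fixes-a = trans (cong (σ ⟨$⟩ʳ_) (transpose-source p a))
      (transpose-other q′ b a (λ a≡q′ → p≢q (⟨$⟩ʳ-injective τ (trans (transpose-source p a) a≡q′))) a≢b)

  δ-relabel : ∀ (ρ : Permutation′ n) x y → δ (ρ ⟨$⟩ʳ x) (ρ ⟨$⟩ʳ y) ≡ δ x y
  δ-relabel ρ x y = 𝟙-cong (⟨$⟩ʳ-injective ρ) (cong (ρ ⟨$⟩ʳ_)) (_ ≟ _) (x ≟ y)

  isPerm-relabel : ∀ (ρ : Permutation′ n) w → isPerm (Vec.map (ρ ⟨$⟩ʳ_) w) ≡ isPerm w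
  isPerm-relabel ρ w = trans (cong uniq (VecP.toList-map (ρ ⟨$⟩ʳ_) w))
                             (uniq-cong {xs = map (ρ ⟨$⟩ʳ_) (toList w)} {ys = toList w} Unique.map⁻ (Unique.map⁺ (⟨$⟩ʳ-injective ρ)))

  toList-Unique⁻ : ∀ {k} (w : Vec (Fin n) k) → Unique (toList w) → VecUnique.Unique w
  toList-Unique⁻ Vec.[]      []         = []
  toList-Unique⁻ (x Vec.∷ w) (x∉w ∷ uw) = VecAll.toList⁻ x∉w ∷ toList-Unique⁻ w uw

  -- #{σ ∈ S n | σ p = a, σ q = b}, permutations being encoded as duplicate-free tables.
  pinned : Fin n → Fin n → Fin n → Fin n → ℕ
  pinned p a q b = ∑ᵛ n (λ w → isPerm w * (δ (lookup w p) a * δ (lookup w q) b))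

  pinned-relabel : ∀ (ρ : Permutation′ n) p a q b → pinned p (ρ ⟨$⟩ʳ a) q (ρ ⟨$⟩ʳ b) ≡ pinned p a q b
  pinned-relabel ρ p a q b = trans (sym (∑ᵛ-relabel n ρ _)) (∑ᵛ-cong n relabel)
    where
    relabel : ∀ w → isPerm (Vec.map (ρ ⟨$⟩ʳ_) w)
                      * (δ (lookup (Vec.map (ρ ⟨$⟩ʳ_) w) p) (ρ ⟨$⟩ʳ a) * δ (lookup (Vec.map (ρ ⟨$⟩ʳ_) w) q) (ρ ⟨$⟩ʳ b))
                  ≡ isPerm w * (δ (lookup w p) a * δ (lookup w q) b)
    relabel w rewrite VecP.lookup-map p (ρ ⟨$⟩ʳ_) w | VecP.lookup-map q (ρ ⟨$⟩ʳ_) w =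
      cong₂ _*_ (isPerm-relabel ρ w) (cong₂ _*_ (δ-relabel ρ _ a) (δ-relabel ρ _ b))

  pinned-transitive₁ : ∀ p a → pinned p a p a ≡ pinned p p p p
  pinned-transitive₁ p a = trans (cong (λ c → pinned p c p c) (sym (transpose-source p a)))
                              (pinned-relabel (transpose p a) p p p p)

  pinned-transitive₂ : ∀ {p q a b} → p ≢ q → a ≢ b → pinned p a q b ≡ pinned p p q q
  pinned-transitive₂ {p} {q} p≢q a≢b with relabelling₂ p≢q a≢b
  ... | ρ , refl , refl = pinned-relabel ρ p p q q

  pinned-clash-values : ∀ p {a b} → a ≢ b → pinned p a p b ≡ 0
  pinned-clash-values p {a} {b} a≢b =
    ∑ᵛ-zero n (λ w → trans (cong (isPerm w *_) (δ-*-δ≡0 {x = lookup w p} {a} {lookup w p} {b} (λ wp≡a wp≡b → a≢b (trans (sym wp≡a) wp≡b))))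
                           (ℕP.*-zeroʳ (isPerm w)))

  pinned-clash-points : ∀ {p q} a → p ≢ q → pinned p a q a ≡ 0
  pinned-clash-points {p} {q} a p≢q = ∑ᵛ-zero n clash
    where
    clash : ∀ w → isPerm w * (δ (lookup w p) a * δ (lookup w q) a) ≡ 0
    clash w with UniqueDec.unique? _≟_ (toList w)
    ... | no  _ = refl
    ... | yes u = cong (1 *_) (δ-*-δ≡0 (λ wp≡a wq≡a →
                     p≢q (VecUnique.lookup-injective (toList-Unique⁻ w u) p q (trans wp≡a (sym wq≡a)))))

  ∑∑-pinned : ∀ p q → ∑[ a < n ] ∑[ b < n ] pinned p a q b ≡ n !
  ∑∑-pinned p q = begin
    ∑[ a < n ] ∑[ b < n ] pinned p a q b                 ≡⟨ sum-cong-≗ {n} (λ a → ∑ᵛ-∑-comm n (λ w b → summand w a b)) ⟨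
    ∑[ a < n ] ∑ᵛ n (λ w → ∑[ b < n ] summand w a b)      ≡⟨ ∑ᵛ-∑-comm n (λ w a → ∑[ b < n ] summand w a b) ⟨
    ∑ᵛ n (λ w → ∑[ a < n ] ∑[ b < n ] summand w a b)      ≡⟨ ∑ᵛ-cong n collapse ⟩
    ∑ᵛ n isPerm                                          ≡⟨ ∑ᵛ-isPerm {n} ⟩
    n !                                                  ∎
    where
    open ≡-Reasoning
    summand : Vec (Fin n) n → Fin n → Fin n → ℕ
    summand w a b = isPerm w * (δ (lookup w p) a * δ (lookup w q) b)
    reorder : ∀ u x y → u * (x * y) ≡ x * (y * u)
    reorder = solve-∀
    collapse : ∀ w → ∑[ a < n ] ∑[ b < n ] summand w a b ≡ isPerm w
    collapse w = begin
      ∑[ a < n ] ∑[ b < n ] summand w a b                                   ≡⟨ sum-cong-≗ {n} (λ a → sum-cong-≗ {n} (λ b → reorder (isPerm w) (δ (lookup w p) a) (δ (lookup w q) b))) ⟩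
      ∑[ a < n ] ∑[ b < n ] (δ (lookup w p) a * (δ (lookup w q) b * isPerm w)) ≡⟨ sum-cong-≗ {n} (λ a → sym (*-distribˡ-sum (δ (lookup w p) a) (λ b → δ (lookup w q) b * isPerm w))) ⟩
      ∑[ a < n ] (δ (lookup w p) a * ∑[ b < n ] (δ (lookup w q) b * isPerm w)) ≡⟨ sum-cong-≗ {n} (λ a → cong (δ (lookup w p) a *_) (∑-δ-* (lookup w q) (λ _ → isPerm w))) ⟩
      ∑[ a < n ] (δ (lookup w p) a * isPerm w)                               ≡⟨ ∑-δ-* (lookup w p) (λ _ → isPerm w) ⟩
      isPerm w                                                               ∎

  pinned-same-point : ∀ p a b → pinned p a p b ≡ δ a b * pinned p p p p
  pinned-same-point p a b = by-cases (a ≟ b)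
    where
    by-cases : Dec (a ≡ b) → pinned p a p b ≡ δ a b * pinned p p p p
    by-cases (yes refl) = trans (pinned-transitive₁ p a)
      (sym (trans (cong (_* pinned p p p p) (𝟙-yes refl (a ≟ a))) (ℕP.*-identityˡ _)))
    by-cases (no a≢b)   = trans (pinned-clash-values p a≢b)
      (sym (cong (_* pinned p p p p) (𝟙-no a≢b (a ≟ b))))

  pinned-distinct-points : ∀ {p q} → p ≢ q → ∀ a b → pinned p a q b ≡ (1 ∸ δ a b) * pinned p p q q
  pinned-distinct-points {p} {q} p≢q a b = by-cases (a ≟ b)
    where
    by-cases : Dec (a ≡ b) → pinned p a q b ≡ (1 ∸ δ a b) * pinned p p q q
    by-cases (yes refl) = trans (pinned-clash-points a p≢q)
      (sym (cong (λ d → (1 ∸ d) * pinned p p q q) (𝟙-yes refl (a ≟ a))))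
    by-cases (no a≢b)   = trans (pinned-transitive₂ p≢q a≢b)
      (sym (trans (cong (λ d → (1 ∸ d) * pinned p p q q) (𝟙-no a≢b (a ≟ b))) (ℕP.*-identityˡ _)))

  n*pinned-diagonal : ∀ p → n * pinned p p p p ≡ n !
  n*pinned-diagonal p = begin
    n * pinned p p p p                                    ≡⟨ ∑-const n _ ⟨
    ∑[ a < n ] pinned p p p p                             ≡⟨ sum-cong-≗ {n} (λ a → ∑-δ-* a (λ _ → pinned p p p p)) ⟨
    ∑[ a < n ] ∑[ b < n ] (δ a b * pinned p p p p)         ≡⟨ sum-cong-≗ {n} (λ a → sum-cong-≗ {n} (pinned-same-point p a)) ⟨
    ∑[ a < n ] ∑[ b < n ] pinned p a p b                  ≡⟨ ∑∑-pinned p p ⟩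
    n !                                                   ∎
    where open ≡-Reasoning

  n*[n∸1]*pinned-off-diagonal : ∀ {p q} → p ≢ q → n * ((n ∸ 1) * pinned p p q q) ≡ n !
  n*[n∸1]*pinned-off-diagonal {p} {q} p≢q = begin
    n * ((n ∸ 1) * pinned p p q q)                        ≡⟨ ∑-const n _ ⟨
    ∑[ a < n ] ((n ∸ 1) * pinned p p q q)                 ≡⟨ sum-cong-≗ {n} (λ a → cong (_* pinned p p q q) (∑-1∸δ a)) ⟨
    ∑[ a < n ] (∑[ b < n ] (1 ∸ δ a b) * pinned p p q q)   ≡⟨ sum-cong-≗ {n} (λ a → *-distribʳ-sum (pinned p p q q) (λ b → 1 ∸ δ a b)) ⟩
    ∑[ a < n ] ∑[ b < n ] ((1 ∸ δ a b) * pinned p p q q)   ≡⟨ sum-cong-≗ {n} (λ a → sum-cong-≗ {n} (pinned-distinct-points p≢q a)) ⟨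
    ∑[ a < n ] ∑[ b < n ] pinned p a q b                  ≡⟨ ∑∑-pinned p q ⟩
    n !                                                   ∎
    where open ≡-Reasoning

  -- Moments of the number of fixed points

  Ftab-∑ : ∀ w → Ftab w ≡ ∑[ p < n ] δ (lookup w p) p
  Ftab-∑ w = trans (length-filter (λ i → lookup w i ≟ i) (allFin n))
                   (∑ₗ-tabulate (λ i → δ (lookup w i) i) (λ i → i))

  ∑ᵛ-isPerm-Ftab : ∑ᵛ n (λ w → isPerm w * Ftab w) ≡ ∑[ p < n ] pinned p p p p
  ∑ᵛ-isPerm-Ftab = begin
    ∑ᵛ n (λ w → isPerm w * Ftab w)                                       ≡⟨ ∑ᵛ-cong n expand ⟩
    ∑ᵛ n (λ w → ∑[ p < n ] (isPerm w * (δ (lookup w p) p * δ (lookup w p) p))) ≡⟨ ∑ᵛ-∑-comm n (λ w p → isPerm w * (δ (lookup w p) p * δ (lookup w p) p)) ⟩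
    ∑[ p < n ] pinned p p p p                                            ∎
    where
    open ≡-Reasoning
    expand : ∀ w → isPerm w * Ftab w ≡ ∑[ p < n ] (isPerm w * (δ (lookup w p) p * δ (lookup w p) p))
    expand w = trans (cong (isPerm w *_) (Ftab-∑ w))
      (trans (*-distribˡ-sum (isPerm w) (λ p → δ (lookup w p) p))
             (sum-cong-≗ {n} (λ p → cong (isPerm w *_) (sym (δ-idem (lookup w p) p)))))

  ∑ᵛ-isPerm-Ftab≡n! : .{{NonZero n}} → ∑ᵛ n (λ w → isPerm w * Ftab w) ≡ n !
  ∑ᵛ-isPerm-Ftab≡n! = ℕP.*-cancelˡ-≡ _ _ n (begin
    n * ∑ᵛ n (λ w → isPerm w * Ftab w)           ≡⟨ cong (n *_) ∑ᵛ-isPerm-Ftab ⟩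
    n * ∑[ p < n ] pinned p p p p                ≡⟨ *-distribˡ-sum n (λ p → pinned p p p p) ⟩
    ∑[ p < n ] (n * pinned p p p p)              ≡⟨ sum-cong-≗ {n} n*pinned-diagonal ⟩
    ∑[ p < n ] (n !)                             ≡⟨ ∑-const n (n !) ⟩
    n * n !                                      ∎)
    where open ≡-Reasoning

  ∑ᵛ-isPerm-Ftab² : ∑ᵛ n (λ w → isPerm w * (Ftab w * Ftab w)) ≡ ∑[ p < n ] ∑[ q < n ] pinned p p q q
  ∑ᵛ-isPerm-Ftab² = begin
    ∑ᵛ n (λ w → isPerm w * (Ftab w * Ftab w))                        ≡⟨ ∑ᵛ-cong n expand ⟩
    ∑ᵛ n (λ w → ∑[ p < n ] ∑[ q < n ] summand w p q)                  ≡⟨ ∑ᵛ-∑-comm n (λ w p → ∑[ q < n ] summand w p q) ⟩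
    ∑[ p < n ] ∑ᵛ n (λ w → ∑[ q < n ] summand w p q)                  ≡⟨ sum-cong-≗ {n} (λ p → ∑ᵛ-∑-comm n (λ w q → summand w p q)) ⟩
    ∑[ p < n ] ∑[ q < n ] pinned p p q q                             ∎
    where
    open ≡-Reasoning
    summand : Vec (Fin n) n → Fin n → Fin n → ℕ
    summand w p q = isPerm w * (δ (lookup w p) p * δ (lookup w q) q)
    expand : ∀ w → isPerm w * (Ftab w * Ftab w) ≡ ∑[ p < n ] ∑[ q < n ] summand w p q
    expand w = begin
      isPerm w * (Ftab w * Ftab w)                                       ≡⟨ cong (λ f → isPerm w * (f * f)) (Ftab-∑ w) ⟩
      isPerm w * (Φ * Φ)                                                 ≡⟨ cong (isPerm w *_) (*-distribʳ-sum Φ (λ p → δ (lookup w p) p)) ⟩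
      isPerm w * ∑[ p < n ] (δ (lookup w p) p * Φ)                       ≡⟨ *-distribˡ-sum (isPerm w) (λ p → δ (lookup w p) p * Φ) ⟩
      ∑[ p < n ] (isPerm w * (δ (lookup w p) p * Φ))                     ≡⟨ sum-cong-≗ {n} (λ p → cong (λ x → isPerm w * x) (*-distribˡ-sum (δ (lookup w p) p) (λ q → δ (lookup w q) q))) ⟩
      ∑[ p < n ] (isPerm w * ∑[ q < n ] (δ (lookup w p) p * δ (lookup w q) q)) ≡⟨ sum-cong-≗ {n} (λ p → *-distribˡ-sum (isPerm w) (λ q → δ (lookup w p) p * δ (lookup w q) q)) ⟩
      ∑[ p < n ] ∑[ q < n ] summand w p q                                ∎
      where
      Φ : ℕ
      Φ = ∑[ p < n ] δ (lookup w p) p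

  n*[n∸1]*pinned-cases : ∀ p q → n * (n ∸ 1) * pinned p p q q ≡ δ p q * ((n ∸ 1) * n !) + (1 ∸ δ p q) * n !
  n*[n∸1]*pinned-cases p q = by-cases (p ≟ q)
    where
    by-cases : Dec (p ≡ q) → n * (n ∸ 1) * pinned p p q q ≡ δ p q * ((n ∸ 1) * n !) + (1 ∸ δ p q) * n !
    by-cases (yes refl) = begin
      n * (n ∸ 1) * pinned p p p p                  ≡⟨ swap-first n (n ∸ 1) _ ⟩
      (n ∸ 1) * (n * pinned p p p p)                ≡⟨ cong ((n ∸ 1) *_) (n*pinned-diagonal p) ⟩
      (n ∸ 1) * n !                                 ≡⟨ drop-zero _ (n !) ⟨
      1 * ((n ∸ 1) * n !) + (1 ∸ 1) * n !           ≡⟨ cong (λ d → d * ((n ∸ 1) * n !) + (1 ∸ d) * n !) (𝟙-yes refl (p ≟ p)) ⟨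
      δ p p * ((n ∸ 1) * n !) + (1 ∸ δ p p) * n !   ∎
      where
      open ≡-Reasoning
      swap-first : ∀ a b c → a * b * c ≡ b * (a * c)
      swap-first = solve-∀
      drop-zero : ∀ x y → 1 * x + 0 * y ≡ x
      drop-zero = solve-∀
    by-cases (no p≢q) = begin
      n * (n ∸ 1) * pinned p p q q                  ≡⟨ ℕP.*-assoc n (n ∸ 1) _ ⟩
      n * ((n ∸ 1) * pinned p p q q)                ≡⟨ n*[n∸1]*pinned-off-diagonal p≢q ⟩
      n !                                           ≡⟨ drop-zero ((n ∸ 1) * n !) (n !) ⟨
      0 * ((n ∸ 1) * n !) + (1 ∸ 0) * n !           ≡⟨ cong (λ d → d * ((n ∸ 1) * n !) + (1 ∸ d) * n !) (𝟙-no p≢q (p ≟ q)) ⟨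
      δ p q * ((n ∸ 1) * n !) + (1 ∸ δ p q) * n !   ∎
      where
      open ≡-Reasoning
      drop-zero : ∀ x y → 0 * x + 1 * y ≡ y
      drop-zero = solve-∀

  ∑ᵛ-isPerm-Ftab²≡2*n! : .{{NonZero (n * (n ∸ 1))}} → ∑ᵛ n (λ w → isPerm w * (Ftab w * Ftab w)) ≡ 2 * n !
  ∑ᵛ-isPerm-Ftab²≡2*n! = ℕP.*-cancelˡ-≡ _ _ (n * (n ∸ 1)) (begin
    c * ∑ᵛ n (λ w → isPerm w * (Ftab w * Ftab w))                 ≡⟨ cong (c *_) ∑ᵛ-isPerm-Ftab² ⟩
    c * ∑[ p < n ] ∑[ q < n ] pinned p p q q                      ≡⟨ *-distribˡ-sum c (λ p → ∑[ q < n ] pinned p p q q) ⟩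
    ∑[ p < n ] (c * ∑[ q < n ] pinned p p q q)                    ≡⟨ sum-cong-≗ {n} (λ p → *-distribˡ-sum c (λ q → pinned p p q q)) ⟩
    ∑[ p < n ] ∑[ q < n ] (c * pinned p p q q)                    ≡⟨ sum-cong-≗ {n} (λ p → sum-cong-≗ {n} (n*[n∸1]*pinned-cases p)) ⟩
    ∑[ p < n ] ∑[ q < n ] (δ p q * X + (1 ∸ δ p q) * n !)         ≡⟨ sum-cong-≗ {n} row ⟩
    ∑[ p < n ] (X + (n ∸ 1) * n !)                                ≡⟨ ∑-const n _ ⟩
    n * (X + (n ∸ 1) * n !)                                       ≡⟨ regroup n (n ∸ 1) (n !) ⟩
    c * (2 * n !)                                                 ∎)
    where
    open ≡-Reasoning
    c X : ℕ
    c = n * (n ∸ 1)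
    X = (n ∸ 1) * n !
    row : ∀ p → ∑[ q < n ] (δ p q * X + (1 ∸ δ p q) * n !) ≡ X + (n ∸ 1) * n !
    row p = begin
      ∑[ q < n ] (δ p q * X + (1 ∸ δ p q) * n !)            ≡⟨ ∑-distrib-+ (λ q → δ p q * X) (λ q → (1 ∸ δ p q) * n !) ⟩
      ∑[ q < n ] (δ p q * X) + ∑[ q < n ] ((1 ∸ δ p q) * n !) ≡⟨ cong₂ _+_ (∑-δ-* p (λ _ → X)) (sym (*-distribʳ-sum (n !) (λ q → 1 ∸ δ p q))) ⟩
      X + ∑[ q < n ] (1 ∸ δ p q) * n !                       ≡⟨ cong (λ s → X + s * n !) (∑-1∸δ p) ⟩
      X + (n ∸ 1) * n !                                     ∎
    regroup : ∀ a b f → a * (b * f + b * f) ≡ a * b * (2 * f)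
    regroup = solve-∀

  Ftab≤n : ∀ w → Ftab w ≤ n
  Ftab≤n w = ℕP.≤-trans (ListP.length-filter (λ i → lookup w i ≟ i) (allFin n))
                        (ℕP.≤-reflexive (ListP.length-tabulate (λ i → i)))

  v-∑ᵛ : ∀ j → v n j ≡ ∑ᵛ n (λ w → isPerm w * 𝟙 (Ftab w ℕ.≟ n ∸ j))
  v-∑ᵛ j = begin
    v n j                                                        ≡⟨ length-filter (λ w → Ftab w ℕ.≟ n ∸ j) (filter isPerm? (allVecs n n)) ⟩
    ∑ₗ (λ w → 𝟙 (Ftab w ℕ.≟ n ∸ j)) (filter isPerm? (allVecs n n)) ≡⟨ ∑ₗ-filter isPerm? _ (allVecs n n) ⟩
    ∑ₗ (λ w → isPerm w * 𝟙 (Ftab w ℕ.≟ n ∸ j)) (allVecs n n)     ≡⟨ ∑ₗ-allVecs n _ ⟩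
    ∑ᵛ n (λ w → isPerm w * 𝟙 (Ftab w ℕ.≟ n ∸ j))                 ∎
    where
    open ≡-Reasoning
    isPerm? : ∀ (w : Vec (Fin n) n) → Dec (Unique (toList w))
    isPerm? w = UniqueDec.unique? _≟_ (toList w)

  ∑-select-distance : ∀ w (g : ℕ → ℕ) → ∑ₗ (λ j → 𝟙 (Ftab w ℕ.≟ n ∸ j) * g j) (upTo (suc n)) ≡ g (n ∸ Ftab w)
  ∑-select-distance w g = begin
    ∑ₗ (λ j → 𝟙 (Ftab w ℕ.≟ n ∸ j) * g j) (upTo (suc n))              ≡⟨ ∑ₗ-applyUpTo _ (λ j → j) (suc n) ⟩
    ∑[ i < suc n ] (𝟙 (Ftab w ℕ.≟ n ∸ toℕ i) * g (toℕ i))          ≡⟨ sum-cong-≗ {suc n} (λ i → cong (_* g (toℕ i)) (swap i)) ⟩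
    ∑[ i < suc n ] (𝟙 (toℕ i ℕ.≟ n ∸ Ftab w) * g (toℕ i))          ≡⟨ ∑-toℕ-select (n ∸ Ftab w) g (s≤s (ℕP.m∸n≤m n (Ftab w))) ⟩
    g (n ∸ Ftab w)                                                 ∎
    where
    open ≡-Reasoning
    swap : ∀ (i : Fin (suc n)) → 𝟙 (Ftab w ℕ.≟ n ∸ toℕ i) ≡ 𝟙 (toℕ i ℕ.≟ n ∸ Ftab w)
    swap i = 𝟙-cong (λ eq → trans (sym (ℕP.m∸[m∸n]≡n (toℕ≤pred[n] i))) (cong (n ∸_) (sym eq)))
                    (λ eq → trans (sym (ℕP.m∸[m∸n]≡n (Ftab≤n w))) (cong (n ∸_) (sym eq)))
                    (Ftab w ℕ.≟ n ∸ toℕ i) (toℕ i ℕ.≟ n ∸ Ftab w)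

  ∑-v*g : ∀ (g : ℕ → ℕ) → ∑ₗ (λ j → v n j * g j) (upTo (suc n)) ≡ ∑ᵛ n (λ w → isPerm w * g (n ∸ Ftab w))
  ∑-v*g g = begin
    ∑ₗ (λ j → v n j * g j) (upTo (suc n))                                       ≡⟨ ∑ₗ-cong (λ j → cong (_* g j) (v-∑ᵛ j)) (upTo (suc n)) ⟩
    ∑ₗ (λ j → ∑ᵛ n (λ w → isPerm w * 𝟙 (Ftab w ℕ.≟ n ∸ j)) * g j) (upTo (suc n))  ≡⟨ ∑ₗ-cong pull-in (upTo (suc n)) ⟩
    ∑ₗ (λ j → ∑ᵛ n (λ w → isPerm w * (𝟙 (Ftab w ℕ.≟ n ∸ j) * g j))) (upTo (suc n)) ≡⟨ ∑ₗ-∑ᵛ-comm n (λ j w → isPerm w * (𝟙 (Ftab w ℕ.≟ n ∸ j) * g j)) (upTo (suc n)) ⟩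
    ∑ᵛ n (λ w → ∑ₗ (λ j → isPerm w * (𝟙 (Ftab w ℕ.≟ n ∸ j) * g j)) (upTo (suc n))) ≡⟨ ∑ᵛ-cong n (λ w → ∑ₗ-*ˡ (isPerm w) (λ j → 𝟙 (Ftab w ℕ.≟ n ∸ j) * g j) (upTo (suc n))) ⟩
    ∑ᵛ n (λ w → isPerm w * ∑ₗ (λ j → 𝟙 (Ftab w ℕ.≟ n ∸ j) * g j) (upTo (suc n))) ≡⟨ ∑ᵛ-cong n (λ w → cong (isPerm w *_) (∑-select-distance w g)) ⟩
    ∑ᵛ n (λ w → isPerm w * g (n ∸ Ftab w))                                      ∎
    where
    open ≡-Reasoning
    pull-in : ∀ j → ∑ᵛ n (λ w → isPerm w * 𝟙 (Ftab w ℕ.≟ n ∸ j)) * g j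
                  ≡ ∑ᵛ n (λ w → isPerm w * (𝟙 (Ftab w ℕ.≟ n ∸ j) * g j))
    pull-in j = trans (ℕP.*-comm _ (g j)) (trans (sym (∑ᵛ-*ˡ n (g j) _))
                  (∑ᵛ-cong n (λ w → rotate (g j) (isPerm w) (𝟙 (Ftab w ℕ.≟ n ∸ j)))))
      where
      rotate : ∀ c u d → c * (u * d) ≡ u * (d * c)
      rotate = solve-∀

u*[n∸f]+u*f≡n*u : ∀ u {n f} → f ≤ n → u * (n ∸ f) + u * f ≡ n * u
u*[n∸f]+u*f≡n*u u {n} {f} f≤n = begin
  u * (n ∸ f) + u * f    ≡⟨ ℕP.*-distribˡ-+ u (n ∸ f) f ⟨
  u * (n ∸ f + f)        ≡⟨ cong (u *_) (ℕP.m∸n+n≡m f≤n) ⟩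
  u * n                  ≡⟨ ℕP.*-comm u n ⟩
  n * u                  ∎
  where open ≡-Reasoning

u*[n∸f]²+2n*u*f≡n²*u+u*f² : ∀ u {n f} → f ≤ n →
                            u * (n ∸ f) ^ 2 + 2 * n * (u * f) ≡ n * n * u + u * (f * f)
u*[n∸f]²+2n*u*f≡n²*u+u*f² u {n} {f} f≤n = begin
  u * e ^ 2 + 2 * n * (u * f)               ≡⟨ cong (λ k → u * e ^ 2 + 2 * k * (u * f)) n≡e+f ⟩
  u * e ^ 2 + 2 * (e + f) * (u * f)         ≡⟨ square-identity u e f ⟩
  (e + f) * (e + f) * u + u * (f * f)       ≡⟨ cong (λ k → k * k * u + u * (f * f)) n≡e+f ⟨
  n * n * u + u * (f * f)                   ∎
  where
  open ≡-Reasoning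
  e : ℕ
  e = n ∸ f
  n≡e+f : n ≡ e + f
  n≡e+f = sym (ℕP.m∸n+n≡m f≤n)
  square-identity : ∀ u e f → u * (e * (e * 1)) + 2 * (e + f) * (u * f) ≡ (e + f) * (e + f) * u + u * (f * f)
  square-identity = solve-∀

∑-v*j : ∀ n .{{_ : NonZero n}} → ∑ₗ (λ j → v n j * j) (upTo (suc n)) ≡ (n ∸ 1) * n !
∑-v*j n@(suc m) = ℕP.+-cancelʳ-≡ (n !) _ _ (begin
  ∑ₗ (λ j → v n j * j) (upTo (suc n)) + n !                     ≡⟨ cong₂ _+_ (∑-v*g {n} (λ j → j)) (sym (∑ᵛ-isPerm-Ftab≡n! {n})) ⟩
  ∑ᵛ n (λ w → isPerm w * d w) + ∑ᵛ n (λ w → isPerm w * Ftab w) ≡⟨ ∑ᵛ-+ n (λ w → isPerm w * d w) (λ w → isPerm w * Ftab w) ⟨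
  ∑ᵛ n (λ w → isPerm w * d w + isPerm w * Ftab w)              ≡⟨ ∑ᵛ-cong n (λ w → u*[n∸f]+u*f≡n*u (isPerm w) (Ftab≤n w)) ⟩
  ∑ᵛ n (λ w → n * isPerm w)                                    ≡⟨ ∑ᵛ-*ˡ n n isPerm ⟩
  n * ∑ᵛ n isPerm                                              ≡⟨ cong (n *_) (∑ᵛ-isPerm {n}) ⟩
  n * n !                                                      ≡⟨ ℕP.+-comm (n !) (m * n !) ⟩
  m * n ! + n !                                                ∎)
  where
  open ≡-Reasoning
  d : Vec (Fin n) n → ℕ
  d w = n ∸ Ftab w

∑-v*j² : ∀ n → 2 ≤ n → ∑ₗ (λ j → v n j * j ^ 2) (upTo (suc n)) ≡ (1 + (n ∸ 1) ^ 2) * n !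
∑-v*j² n@(suc (suc m)) (s≤s (s≤s z≤n)) = ℕP.+-cancelʳ-≡ (2 * n * n !) _ _ (begin
  ∑ₗ (λ j → v n j * j ^ 2) (upTo (suc n)) + 2 * n * n !
    ≡⟨ cong₂ _+_ (∑-v*g {n} (λ j → j ^ 2)) (cong (2 * n *_) (sym (∑ᵛ-isPerm-Ftab≡n! {n}))) ⟩
  ∑ᵛ n (λ w → isPerm w * d w ^ 2) + 2 * n * ∑ᵛ n (λ w → isPerm w * Ftab w)
    ≡⟨ cong (_+_ (∑ᵛ n (λ w → isPerm w * d w ^ 2))) (∑ᵛ-*ˡ n (2 * n) (λ w → isPerm w * Ftab w)) ⟨
  ∑ᵛ n (λ w → isPerm w * d w ^ 2) + ∑ᵛ n (λ w → 2 * n * (isPerm w * Ftab w))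
    ≡⟨ ∑ᵛ-+ n (λ w → isPerm w * d w ^ 2) (λ w → 2 * n * (isPerm w * Ftab w)) ⟨
  ∑ᵛ n (λ w → isPerm w * d w ^ 2 + 2 * n * (isPerm w * Ftab w))
    ≡⟨ ∑ᵛ-cong n (λ w → u*[n∸f]²+2n*u*f≡n²*u+u*f² (isPerm w) (Ftab≤n w)) ⟩
  ∑ᵛ n (λ w → n * n * isPerm w + isPerm w * (Ftab w * Ftab w))
    ≡⟨ ∑ᵛ-+ n (λ w → n * n * isPerm w) (λ w → isPerm w * (Ftab w * Ftab w)) ⟩
  ∑ᵛ n (λ w → n * n * isPerm w) + ∑ᵛ n (λ w → isPerm w * (Ftab w * Ftab w))
    ≡⟨ cong₂ _+_ (trans (∑ᵛ-*ˡ n (n * n) isPerm) (cong (n * n *_) (∑ᵛ-isPerm {n}))) (∑ᵛ-isPerm-Ftab²≡2*n! {n}) ⟩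
  n * n * n ! + 2 * n !
    ≡⟨ regroup m (n !) ⟩
  (1 + (n ∸ 1) ^ 2) * n ! + 2 * n * n !
    ∎)
  where
  open ≡-Reasoning
  d : Vec (Fin n) n → ℕ
  d w = n ∸ Ftab w
  regroup : ∀ m f → (2 + m) * (2 + m) * f + 2 * f ≡ (1 + (1 + m) * ((1 + m) * 1)) * f + 2 * (2 + m) * f
  regroup = solve-∀

Σ0to-cong : ∀ N {f g : ℕ → ℚ} → (∀ j → f j ≡ g j) → Σ0to N f ≡ Σ0to N g
Σ0to-cong N f≗g = cong (foldr ℚ._+_ 0ℚ) (ListP.map-cong f≗g (upTo (suc N)))

foldr-+-/1+ : ∀ b (h : ℕ → ℕ) xs → foldr ℚ._+_ 0ℚ (map (λ j → h j /1+ b) xs) ≡ ∑ₗ h xs /1+ b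
foldr-+-/1+ b h []       = /1+-cong 0 0 0 b refl
foldr-+-/1+ b h (x ∷ xs) = trans (cong (h x /1+ b ℚ.+_) (foldr-+-/1+ b h xs)) (/1+-+ (h x) (∑ₗ h xs) b)

Σ0to-ratio : ∀ N d .{{_ : NonZero d}} (h g : ℕ → ℕ) c → ∑ₗ (λ j → h j * g j) (upTo (suc N)) ≡ c * d →
             Σ0to N (λ j → ratio (h j) d *ℚ ℚof (g j)) ≡ ℚof c
Σ0to-ratio N (suc b) h g c ∑≡c*d = begin
  Σ0to N (λ j → h j /1+ b *ℚ ℚof (g j))         ≡⟨ Σ0to-cong N (λ j → /1+-*-ℚof (h j) b (g j)) ⟩
  Σ0to N (λ j → (h j * g j) /1+ b)              ≡⟨ foldr-+-/1+ b (λ j → h j * g j) (upTo (suc N)) ⟩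
  ∑ₗ (λ j → h j * g j) (upTo (suc N)) /1+ b     ≡⟨ cong (_/1+ b) ∑≡c*d ⟩
  (c * suc b) /1+ b                             ≡⟨ *-/1+-cancel c b ⟩
  ℚof c                                         ∎
  where open ≡-Reasoning

design-moment₁ : ∀ n .{{_ : NonZero n}} → Σ0to n (λ j → ratio (v n j) (n !) *ℚ ℚof j) ≡ ℚof (n ∸ 1)
design-moment₁ n = Σ0to-ratio n (n !) {{n ℕP.!≢0}} (v n) (λ j → j) (n ∸ 1) (∑-v*j n)

design-moment₂ : ∀ n → 2 ≤ n → Σ0to n (λ j → ratio (v n j) (n !) *ℚ ℚof (j ^ 2)) ≡ ℚof (1 + (n ∸ 1) ^ 2)
design-moment₂ n 2≤n = Σ0to-ratio n (n !) {{n ℕP.!≢0}} (v n) (λ j → j ^ 2) (1 + (n ∸ 1) ^ 2) (∑-v*j² n 2≤n)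

Σ0to-^1 : ∀ N (f : ℕ → ℚ) → Σ0to N (λ j → f j *ℚ ℚof (j ^ 1)) ≡ Σ0to N (λ j → f j *ℚ ℚof j)
Σ0to-^1 N f = Σ0to-cong N (λ j → cong (λ k → f j *ℚ ℚof k) (ℕP.*-identityʳ j))

MomentConditions : ∀ {n} → List (S n) → Set
MomentConditions {n} D = (Σ0to n (λ j → freq D j *ℚ ℚof j) ≡ ℚof (n ∸ 1))
                       × (Σ0to n (λ j → freq D j *ℚ ℚof (j ^ 2)) ≡ ℚof (1 + (n ∸ 1) ^ 2))

2-design⇔moments : ∀ n → 2 ≤ n → (D : List (S n)) → IsDesign 2 D ⇔ MomentConditions D
2-design⇔moments n@(suc (suc m)) 2≤n@(s≤s (s≤s z≤n)) D = mk⇔ to from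
  where
  moment₁ : Σ0to n (λ j → ratio (v n j) (n !) *ℚ ℚof (j ^ 1)) ≡ ℚof (n ∸ 1)
  moment₁ = trans (Σ0to-^1 n (λ j → ratio (v n j) (n !))) (design-moment₁ n)
  to : IsDesign 2 D → MomentConditions D
  to design = trans (sym (Σ0to-^1 n (freq D))) (trans (design 1 (s≤s z≤n) (s≤s z≤n)) moment₁)
            , trans (design 2 (s≤s z≤n) ℕP.≤-refl) (design-moment₂ n 2≤n)
  from : MomentConditions D → IsDesign 2 D
  from (first , _) 1 _ _ = trans (Σ0to-^1 n (freq D)) (trans first (sym moment₁))
  from (_ , second) 2 _ _ = trans second (sym (design-moment₂ n 2≤n))
  from _ (suc (suc (suc _))) _ (s≤s (s≤s ()))

map-applyUpTo : ∀ {a} {A : Set a} (g : ℕ → A) f N → map g (applyUpTo f N) ≡ applyUpTo (λ j → g (f j)) N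
map-applyUpTo g f zero    = refl
map-applyUpTo g f (suc N) = cong (g (f 0) ∷_) (map-applyUpTo g (λ j → f (suc j)) N)

Σ0to-suc : ∀ N g → Σ0to (suc N) g ≡ g 0 ℚ.+ Σ0to N (λ j → g (suc j))
Σ0to-suc N g = cong (λ xs → g 0 ℚ.+ foldr ℚ._+_ 0ℚ xs)
                    (trans (map-applyUpTo g suc (suc N)) (sym (map-applyUpTo (λ j → g (suc j)) (λ j → j) (suc N))))

Σ0to-last-two : ∀ m (g : ℕ → ℚ) → (∀ j → j ≤ m → g j ≡ 0ℚ) →
                Σ0to (2 + m) g ≡ g (1 + m) ℚ.+ g (2 + m)
Σ0to-last-two zero    g g≡0 = begin
  g 0 ℚ.+ (g 1 ℚ.+ (g 2 ℚ.+ 0ℚ)) ≡⟨ cong (ℚ._+ (g 1 ℚ.+ (g 2 ℚ.+ 0ℚ))) (g≡0 0 z≤n) ⟩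
  0ℚ ℚ.+ (g 1 ℚ.+ (g 2 ℚ.+ 0ℚ))  ≡⟨ ℚP.+-identityˡ _ ⟩
  g 1 ℚ.+ (g 2 ℚ.+ 0ℚ)           ≡⟨ cong (g 1 ℚ.+_) (ℚP.+-identityʳ (g 2)) ⟩
  g 1 ℚ.+ g 2                    ∎
  where open ≡-Reasoning
Σ0to-last-two (suc m) g g≡0 = begin
  Σ0to (3 + m) g                             ≡⟨ Σ0to-suc (2 + m) g ⟩
  g 0 ℚ.+ Σ0to (2 + m) (λ j → g (suc j))     ≡⟨ cong₂ ℚ._+_ (g≡0 0 z≤n) (Σ0to-last-two m (λ j → g (suc j)) (λ j j≤m → g≡0 (suc j) (s≤s j≤m))) ⟩
  0ℚ ℚ.+ (g (2 + m) ℚ.+ g (3 + m))           ≡⟨ ℚP.+-identityˡ _ ⟩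
  g (2 + m) ℚ.+ g (3 + m)                    ∎
  where open ≡-Reasoning

two-point-moment : ∀ m k → ratio m (suc m) *ℚ ℚof (suc m ^ suc k) ℚ.+ ratio 1 (2 + m) *ℚ ℚof ((2 + m) ^ suc k)
                           ≡ ℚof (m * suc m ^ k + (2 + m) ^ k)
two-point-moment m k = begin
  ratio m (suc m) *ℚ ℚof (suc m ^ suc k) ℚ.+ ratio 1 (2 + m) *ℚ ℚof ((2 + m) ^ suc k)
    ≡⟨ cong₂ ℚ._+_ (/1+-*-ℚof m m (suc m ^ suc k)) (/1+-*-ℚof 1 (suc m) ((2 + m) ^ suc k)) ⟩
  (m * suc m ^ suc k) /1+ m ℚ.+ (1 * (2 + m) ^ suc k) /1+ suc m
    ≡⟨ cong₂ ℚ._+_ (/1+-cong (m * suc m ^ suc k) m (m * suc m ^ k) 0 (cancel m (suc m) (suc m ^ k)))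
                   (/1+-cong (1 * (2 + m) ^ suc k) (suc m) (1 * (2 + m) ^ k) 0 (cancel 1 (2 + m) ((2 + m) ^ k))) ⟩
  (m * suc m ^ k) /1+ 0 ℚ.+ (1 * (2 + m) ^ k) /1+ 0
    ≡⟨ /1+-+ (m * suc m ^ k) (1 * (2 + m) ^ k) 0 ⟩
  (m * suc m ^ k + 1 * (2 + m) ^ k) /1+ 0
    ≡⟨ cong (λ x → (m * suc m ^ k + x) /1+ 0) (ℕP.*-identityˡ ((2 + m) ^ k)) ⟩
  ℚof (m * suc m ^ k + (2 + m) ^ k)
    ∎
  where
  open ≡-Reasoning
  cancel : ∀ a s x → a * (s * x) * 1 ≡ a * x * s
  cancel = solve-∀

two-point-frequencies-moment : ∀ m (D : List (S (2 + m))) →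
  (∀ i → 1 ≤ i → i ≤ m → freq D i ≡ 0ℚ) →
  freq D (1 + m) ≡ ratio m (1 + m) → freq D (2 + m) ≡ ratio 1 (2 + m) →
  ∀ k → Σ0to (2 + m) (λ j → freq D j *ℚ ℚof (j ^ suc k)) ≡ ℚof (m * suc m ^ k + (2 + m) ^ k)
two-point-frequencies-moment m D f≡0 f₁ f₂ k = begin
  Σ0to (2 + m) term                          ≡⟨ Σ0to-last-two m term term≡0 ⟩
  term (1 + m) ℚ.+ term (2 + m)              ≡⟨ cong₂ ℚ._+_ (cong (_*ℚ ℚof (suc m ^ suc k)) f₁) (cong (_*ℚ ℚof ((2 + m) ^ suc k)) f₂) ⟩
  ratio m (suc m) *ℚ ℚof (suc m ^ suc k) ℚ.+ ratio 1 (2 + m) *ℚ ℚof ((2 + m) ^ suc k)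
                                             ≡⟨ two-point-moment m k ⟩
  ℚof (m * suc m ^ k + (2 + m) ^ k)          ∎
  where
  open ≡-Reasoning
  term : ℕ → ℚ
  term j = freq D j *ℚ ℚof (j ^ suc k)
  term≡0 : ∀ j → j ≤ m → term j ≡ 0ℚ
  term≡0 zero    _   = ℚP.*-zeroʳ (freq D 0)
  term≡0 (suc j) 1+j≤m = trans (cong (_*ℚ ℚof (suc j ^ suc k)) (f≡0 (suc j) (s≤s z≤n) 1+j≤m)) (ℚP.*-zeroˡ (ℚof (suc j ^ suc k)))

two-point⇒moment-conditions : ∀ m (D : List (S (2 + m))) →
  (∀ i → 1 ≤ i → i ≤ m → freq D i ≡ 0ℚ) →
  freq D (1 + m) ≡ ratio m (1 + m) → freq D (2 + m) ≡ ratio 1 (2 + m) → MomentConditions D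
two-point⇒moment-conditions m D f≡0 f₁ f₂ =
    trans (sym (Σ0to-^1 (2 + m) (freq D)))
          (trans (moment 0) (cong ℚof (trans (cong (_+ 1) (ℕP.*-identityʳ m)) (ℕP.+-comm m 1))))
  , trans (moment 1) (cong ℚof (square m))
  where
  moment : ∀ k → Σ0to (2 + m) (λ j → freq D j *ℚ ℚof (j ^ suc k)) ≡ ℚof (m * suc m ^ k + (2 + m) ^ k)
  moment = two-point-frequencies-moment m D f≡0 f₁ f₂
  square : ∀ m → m * (suc m * 1) + (2 + m) * 1 ≡ 1 + suc m * (suc m * 1)
  square = solve-∀

theorem4 : (n : ℕ) → 2 ≤ n → (D : List (S n)) → D ≢ [] → Distinct D →
    (IsDesign 2 D ⇔
      ((Σ0to n (λ j → freq D j *ℚ ℚof j) ≡ ℚof (n ∸ 1))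
       × (Σ0to n (λ j → freq D j *ℚ ℚof (j ^ 2)) ≡ ℚof (1 + (n ∸ 1) ^ 2))))
    × (length D ≡ n * (n ∸ 1) →
       (∀ i → 1 ≤ i → i ≤ n ∸ 2 → freq D i ≡ 0ℚ) →
       freq D (n ∸ 1) ≡ ratio (n ∸ 2) (n ∸ 1) →
       freq D n ≡ ratio 1 n →
       (Σ0to n (λ j → freq D j *ℚ ℚof j) ≡ ℚof (n ∸ 1))
       × (Σ0to n (λ j → freq D j *ℚ ℚof (j ^ 2)) ≡ ℚof (1 + (n ∸ 1) ^ 2)))
theorem4 n@(suc (suc m)) 2≤n@(s≤s (s≤s z≤n)) D _ _ =
  2-design⇔moments n 2≤n D , λ _ → two-point⇒moment-conditions m D
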